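{- Let $p>1$ be an integer and let $u^{(p)}$ be the fixed point of the substitution $\varphi_p(L)=L^pS$, $\varphi_p(S)=M$, $\varphi_p(M)=L^{p-1}S$ starting with $L$. Let $MzM$ be a factor of $u^{(p)}$ such that $z$ contains no letter $M$. Then $z=(L^pS)^p$, or $z=L^{p-1}S(L^pS)^p$, or $z=L^{p-1}S(L^pS)^{p-1}$. Consequently $p^2+p-1\le |z|\le p^2+2p$.
   Context: A factor is a finite contiguous block of $u^{(p)}$; $w^k$ denotes the concatenation of $k$ copies of $w$, and $|z|$ is the length of $z$. -}

module Defs where

open import Data.Nat using (ℕ; zero; suc; _∸_)
open import Data.List using (List; []; _∷_; _++_; concatMap; replicate)
open import Data.List.Membership.Propositional using (_∉_)
open import Data.Product using (∃; Σ; _×_)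
open import Relation.Binary.PropositionalEquality using (_≡_)

data Letter : Set where
  L S M : Letter

_^ʷ_ : List Letter → ℕ → List Letter
w ^ʷ zero  = []
w ^ʷ suc k = w ++ (w ^ʷ k)

φ : ℕ → Letter → List Letter
φ p L = (L ∷ []) ^ʷ p ++ (S ∷ [])
φ p S = M ∷ []
φ p M = (L ∷ []) ^ʷ (p ∸ 1) ++ (S ∷ [])

φ* : ℕ → List Letter → List Letter
φ* p = concatMap (φ p)

-- φ_p^n (L): these are prefixes of the fixed point u^(p) starting with L,
-- and every finite prefix of u^(p) is a prefix of some φ_p^n(L).
iter : ℕ → ℕ → List Letter
iter p zero    = L ∷ []
iter p (suc n) = φ* p (iter p n)

IsFactor : ℕ → List Letter → Set
IsFactor p w = ∃ λ n → Σ (List Letter) λ x → Σ (List Letter) λ y →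
  iter p n ≡ x ++ w ++ y

-- Read u⁽ᵖ⁾ from left to right, remembering the last letter and the words read
-- since the last S and since the last M.  Along every φₚ-iterate of L, each S
-- follows an L and closes a gap Lᵖ, MLᵖ or MLᵖ⁻¹, and each M follows an S.
-- This invariant is carried through φₚ: the M's of φₚ(w) are the images of the
-- S's of w, so the M-gaps of φₚ(w) are the images φₚ(Lᵖ), φₚ(MLᵖ), φₚ(MLᵖ⁻¹)
-- of the S-gaps of w — exactly the three words of the theorem.  For the S-gaps
-- of φₚ(w) one only needs to know which letter precedes each letter of w.
module Submission where

open import Defs
open import Data.Nat using (ℕ; zero; suc; _<_; _≤_; _+_; _*_; _∸_; s≤s)
open import Data.Nat.Properties using (m≤m+n; m∸n≤m; +-monoʳ-≤; +-suc; ≤-refl; ≤-trans)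
open import Data.Nat.Tactic.RingSolver using (solve-∀)
open import Data.List using (List; []; _∷_; _++_; length; foldl; concatMap)
open import Data.List.Properties using (++-assoc; ++-identityʳ; foldl-++; concatMap-++)
open import Data.List.Membership.Propositional using (_∉_)
open import Data.List.Relation.Unary.Any using (here; there)
open import Data.Maybe using (Maybe; just; nothing; map)
open import Data.Maybe.Properties using (map-∘; map-cong; map-id)
open import Data.Maybe.Relation.Unary.All using (All; just; nothing)
open import Data.Maybe.Relation.Unary.All.Properties using (gmap)
open import Data.Sum using (_⊎_; inj₁; inj₂)
open import Data.Product using (_×_; _,_; proj₁; proj₂)
open import Data.Unit using (⊤; tt)
open import Data.Empty using (⊥-elim)
open import Relation.Binary.PropositionalEquality
  using (_≡_; refl; sym; trans; cong; cong₂; subst; module ≡-Reasoning)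

module Acceptance {Q A : Set} (δ : Q → A → Q) (Admissible : Q → A → Set) where

  Accepts : Q → List A → Set
  Accepts q []      = ⊤
  Accepts q (a ∷ w) = Admissible q a × Accepts (δ q a) w

  accepts-++ : ∀ q u v → Accepts q u → Accepts (foldl δ q u) v → Accepts q (u ++ v)
  accepts-++ q []      v _            acc-v = acc-v
  accepts-++ q (a ∷ u) v (ok , acc-u) acc-v = ok , accepts-++ (δ q a) u v acc-u acc-v

  accepts-++⁻ˡ : ∀ q u v → Accepts q (u ++ v) → Accepts q u
  accepts-++⁻ˡ q []      v _          = tt
  accepts-++⁻ˡ q (a ∷ u) v (ok , acc) = ok , accepts-++⁻ˡ (δ q a) u v acc

  accepts-++⁻ʳ : ∀ q u v → Accepts q (u ++ v) → Accepts (foldl δ q u) v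
  accepts-++⁻ʳ q []      v acc       = acc
  accepts-++⁻ʳ q (a ∷ u) v (_ , acc) = accepts-++⁻ʳ (δ q a) u v acc

  module Simulation (h : A → List A) (g : Q → Q)
    (simulate-letter : ∀ q a → Admissible q a →
      Accepts (g q) (h a) × foldl δ (g q) (h a) ≡ g (δ q a)) where

    simulate : ∀ q w → Accepts q w →
      Accepts (g q) (concatMap h w) × foldl δ (g q) (concatMap h w) ≡ g (foldl δ q w)
    simulate q []      _            = tt , refl
    simulate q (a ∷ w) (ok , acc-w) =
      accepts-++ (g q) (h a) (concatMap h w) acc-a
        (subst (λ q′ → Accepts q′ (concatMap h w)) (sym run-a) acc-image)
      , (begin
          foldl δ (g q) (h a ++ concatMap h w)          ≡⟨ foldl-++ δ (g q) (h a) (concatMap h w) ⟩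
          foldl δ (foldl δ (g q) (h a)) (concatMap h w) ≡⟨ cong (λ q′ → foldl δ q′ (concatMap h w)) run-a ⟩
          foldl δ (g (δ q a)) (concatMap h w)           ≡⟨ run-image ⟩
          g (foldl δ (δ q a) w)                         ∎)
      where
      open ≡-Reasoning
      acc-a     = proj₁ (simulate-letter q a ok)
      run-a     = proj₂ (simulate-letter q a ok)
      acc-image = proj₁ (simulate (δ q a) w acc-w)
      run-image = proj₂ (simulate (δ q a) w acc-w)

Lⁿ : ℕ → List Letter
Lⁿ k = (L ∷ []) ^ʷ k

SGap : ℕ → List Letter → Set
SGap p v = v ≡ Lⁿ p ⊎ v ≡ M ∷ Lⁿ p ⊎ v ≡ M ∷ Lⁿ (p ∸ 1)

MGap : ℕ → List Letter → Set
MGap p z = z ≡ φ p L ^ʷ p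
         ⊎ z ≡ Lⁿ (p ∸ 1) ++ S ∷ φ p L ^ʷ p
         ⊎ z ≡ Lⁿ (p ∸ 1) ++ S ∷ φ p L ^ʷ (p ∸ 1)

φ*-Lⁿ : ∀ p k → φ* p (Lⁿ k) ≡ φ p L ^ʷ k
φ*-Lⁿ p zero    = refl
φ*-Lⁿ p (suc k) = cong (φ p L ++_) (φ*-Lⁿ p k)

φ*-SGap : ∀ p {v} → SGap p v → MGap p (φ* p v)
φ*-SGap p (inj₁ refl)        = inj₁ (φ*-Lⁿ p p)
φ*-SGap p (inj₂ (inj₁ refl)) =
  inj₂ (inj₁ (trans (cong (φ p M ++_) (φ*-Lⁿ p p)) (++-assoc (Lⁿ (p ∸ 1)) (S ∷ []) _)))
φ*-SGap p (inj₂ (inj₂ refl)) =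
  inj₂ (inj₂ (trans (cong (φ p M ++_) (φ*-Lⁿ p (p ∸ 1))) (++-assoc (Lⁿ (p ∸ 1)) (S ∷ []) _)))

-- sinceS and sinceM are the words read since the last S and the last M;
-- nothing means that no such letter has been read yet.
record Scanner : Set where
  constructor scanner
  field
    previous : Maybe Letter
    sinceS   : Maybe (List Letter)
    sinceM   : Maybe (List Letter)
open Scanner

append : List Letter → Maybe (List Letter) → Maybe (List Letter)
append w = map (_++ w)

append-append : ∀ u v m → append v (append u m) ≡ append (u ++ v) m
append-append u v m = trans (sym (map-∘ m)) (map-cong (λ x → ++-assoc x u v) m)

append-[] : ∀ m → append [] m ≡ m
append-[] m = trans (map-cong ++-identityʳ m) (map-id m)

step : Scanner → Letter → Scanner
step q L = scanner (just L) (append (L ∷ []) (sinceS q)) (append (L ∷ []) (sinceM q))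
step q S = scanner (just S) (just [])                    (append (S ∷ []) (sinceM q))
step q M = scanner (just M) (append (M ∷ []) (sinceS q)) (just [])

scan : Scanner → List Letter → Scanner
scan = foldl step

start : Scanner
start = scanner nothing nothing nothing

Admissible : ℕ → Scanner → Letter → Set
Admissible p q L = ⊤
Admissible p q S = previous q ≡ just L × All (SGap p) (sinceS q)
Admissible p q M = previous q ≡ just S × All (MGap p) (sinceM q)

open module Accept p = Acceptance step (Admissible p)
  using (Accepts; accepts-++; accepts-++⁻ˡ; accepts-++⁻ʳ)

sinceM-scan : ∀ q z → M ∉ z → sinceM (scan q z) ≡ append z (sinceM q)
sinceM-scan q []      _  = sym (append-[] (sinceM q))
sinceM-scan q (L ∷ z) M∉ = trans (sinceM-scan (step q L) z (λ i → M∉ (there i))) (append-append (L ∷ []) z (sinceM q))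
sinceM-scan q (S ∷ z) M∉ = trans (sinceM-scan (step q S) z (λ i → M∉ (there i))) (append-append (S ∷ []) z (sinceM q))
sinceM-scan q (M ∷ z) M∉ = ⊥-elim (M∉ (here refl))

scan-Lⁿ⁺¹ : ∀ k q → scan q (Lⁿ (suc k)) ≡
  scanner (just L) (append (Lⁿ (suc k)) (sinceS q)) (append (Lⁿ (suc k)) (sinceM q))
scan-Lⁿ⁺¹ zero    q = refl
scan-Lⁿ⁺¹ (suc k) q = trans (scan-Lⁿ⁺¹ k (step q L))
  (cong₂ (scanner (just L)) (append-append (L ∷ []) (Lⁿ (suc k)) (sinceS q))
                            (append-append (L ∷ []) (Lⁿ (suc k)) (sinceM q)))

accepts-Lⁿ : ∀ p k q → Accepts p q (Lⁿ k)
accepts-Lⁿ p zero    q = tt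
accepts-Lⁿ p (suc k) q = tt , accepts-Lⁿ p k (step q L)

-- The scanner state after φₚ(w), computed from the state after w: the last
-- letter of φₚ(a) is M for a = S and S otherwise, and the last S of φₚ(w) is
-- followed by M exactly when w ends in S.
lastOfImage : Letter → Letter
lastOfImage S = M
lastOfImage _ = S

sinceSOfImage : Maybe Letter → Maybe (List Letter)
sinceSOfImage nothing  = nothing
sinceSOfImage (just S) = just (M ∷ [])
sinceSOfImage (just _) = just []

SGap-sinceSOfImage : ∀ p l → All (SGap p) (append (Lⁿ p) (sinceSOfImage l))
SGap-sinceSOfImage p nothing  = nothing
SGap-sinceSOfImage p (just L) = just (inj₁ refl)
SGap-sinceSOfImage p (just S) = just (inj₂ (inj₁ refl))
SGap-sinceSOfImage p (just M) = just (inj₁ refl)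

image : ℕ → Scanner → Scanner
image p q = scanner (map lastOfImage (previous q)) (sinceSOfImage (previous q)) (map (φ* p) (sinceS q))

map-φ*-append : ∀ p a m → map (φ* p) (append (a ∷ []) m) ≡ append (φ p a) (map (φ* p) m)
map-φ*-append p a m = begin
  map (φ* p) (append (a ∷ []) m)         ≡⟨ sym (map-∘ m) ⟩
  map (λ v → φ* p (v ++ a ∷ [])) m       ≡⟨ map-cong φ*-snoc m ⟩
  map (λ v → φ* p v ++ φ p a) m          ≡⟨ map-∘ m ⟩
  append (φ p a) (map (φ* p) m)          ∎
  where
  open ≡-Reasoning
  φ*-snoc : ∀ v → φ* p (v ++ a ∷ []) ≡ φ* p v ++ φ p a
  φ*-snoc v = trans (concatMap-++ (φ p) v (a ∷ [])) (cong (φ* p v ++_) (++-identityʳ (φ p a)))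

accepts-Lⁿ⁺¹S : ∀ p k q → All (SGap p) (append (Lⁿ (suc k)) (sinceS q)) →
  Accepts p q (Lⁿ (suc k) ++ S ∷ []) ×
  scan q (Lⁿ (suc k) ++ S ∷ []) ≡ scanner (just S) (just []) (append (Lⁿ (suc k) ++ S ∷ []) (sinceM q))
accepts-Lⁿ⁺¹S p k q gap =
  accepts-++ p q (Lⁿ (suc k)) (S ∷ []) (accepts-Lⁿ p (suc k) q)
    (subst (λ q′ → Accepts p q′ (S ∷ [])) (sym (scan-Lⁿ⁺¹ k q)) ((refl , gap) , tt))
  , (begin
      scan q (Lⁿ (suc k) ++ S ∷ [])            ≡⟨ foldl-++ step q (Lⁿ (suc k)) (S ∷ []) ⟩
      scan (scan q (Lⁿ (suc k))) (S ∷ [])      ≡⟨ cong (λ q′ → scan q′ (S ∷ [])) (scan-Lⁿ⁺¹ k q) ⟩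
      scanner (just S) (just []) (append (S ∷ []) (append (Lⁿ (suc k)) (sinceM q)))
        ≡⟨ cong (scanner (just S) (just [])) (append-append (Lⁿ (suc k)) (S ∷ []) (sinceM q)) ⟩
      scanner (just S) (just []) (append (Lⁿ (suc k) ++ S ∷ []) (sinceM q)) ∎)
  where open ≡-Reasoning

-- φₚ(M) = Lᵖ⁻¹S must begin with L, which is where p ≥ 2 is needed.
module _ (r : ℕ) where
  private
    p : ℕ
    p = 2 + r

  simulate-letter : ∀ q a → Admissible p q a →
    Accepts p (image p q) (φ p a) × scan (image p q) (φ p a) ≡ image p (step q a)
  simulate-letter (scanner l s m) L _
    with accepts-Lⁿ⁺¹S p (suc r) (image p (scanner l s m)) (SGap-sinceSOfImage p l)
  ... | acc , run = acc , trans run (cong (scanner (just S) (just [])) (sym (map-φ*-append p L s)))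
  simulate-letter (scanner (just L) s m) S (refl , gaps) =
    ((refl , gmap (φ*-SGap p) gaps) , tt) , refl
  simulate-letter (scanner (just S) s m) M (refl , _)
    with accepts-Lⁿ⁺¹S p r (image p (scanner (just S) s m)) (just (inj₂ (inj₂ refl)))
  ... | acc , run = acc , trans run (cong (scanner (just S) (just [])) (sym (map-φ*-append p M s)))

  open Accept.Simulation p (φ p) (image p) simulate-letter

  accepts-iter : ∀ n → Accepts p start (iter p n)
  accepts-iter zero    = tt , tt
  accepts-iter (suc n) = proj₁ (simulate start (iter p n) (accepts-iter n))

MGap-of-factor : ∀ r z → IsFactor (2 + r) (M ∷ z ++ M ∷ []) → M ∉ z → MGap (2 + r) z
MGap-of-factor r z (n , x , y , iter≡) M∉z = gap (subst (All (MGap p)) (sinceM-scan q z M∉z) closing-M)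
  where
  p = 2 + r
  q = step (scan start x) M
  accepted : Accepts p q ((z ++ M ∷ []) ++ y)
  accepted = proj₂ (accepts-++⁻ʳ p start x _ (subst (Accepts p start) iter≡ (accepts-iter r n)))
  closing-M : All (MGap p) (sinceM (scan q z))
  closing-M = proj₂ (proj₁ (accepts-++⁻ʳ p q z (M ∷ []) (accepts-++⁻ˡ p q (z ++ M ∷ []) y accepted)))
  gap : All (MGap p) (just z) → MGap p z
  gap (just g) = g

length-Lⁿ-S : ∀ k w → length (Lⁿ k ++ S ∷ w) ≡ k + suc (length w)
length-Lⁿ-S zero    w = refl
length-Lⁿ-S (suc k) w = cong suc (length-Lⁿ-S k w)

length-φL^ : ∀ p k → length (φ p L ^ʷ k) ≡ k * suc p
length-φL^ p zero    = refl
length-φL^ p (suc k) = begin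
  length ((Lⁿ p ++ S ∷ []) ++ φ p L ^ʷ k) ≡⟨ cong length (++-assoc (Lⁿ p) (S ∷ []) (φ p L ^ʷ k)) ⟩
  length (Lⁿ p ++ S ∷ φ p L ^ʷ k)         ≡⟨ length-Lⁿ-S p (φ p L ^ʷ k) ⟩
  p + suc (length (φ p L ^ʷ k))           ≡⟨ +-suc p _ ⟩
  suc (p + length (φ p L ^ʷ k))           ≡⟨ cong (λ n → suc (p + n)) (length-φL^ p k) ⟩
  suc k * suc p                           ∎
  where open ≡-Reasoning

length-MGap : ∀ q {z} → let p = suc q in MGap p z →
  length z ≡ p * p + p ⊎ length z ≡ p * p + 2 * p ⊎ length z ≡ p * p + p ∸ 1
length-MGap q (inj₁ refl) = inj₁ (trans (length-φL^ (suc q) (suc q)) (lemma q))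
  where
  lemma : ∀ q → suc q * suc (suc q) ≡ suc q * suc q + suc q
  lemma = solve-∀
length-MGap q (inj₂ (inj₁ refl)) =
  inj₂ (inj₁ (trans (length-Lⁿ-S q _) (trans (cong (λ n → q + suc n) (length-φL^ (suc q) (suc q))) (lemma q))))
  where
  lemma : ∀ q → q + suc (suc q * suc (suc q)) ≡ suc q * suc q + 2 * suc q
  lemma = solve-∀
length-MGap q (inj₂ (inj₂ refl)) =
  inj₂ (inj₂ (trans (length-Lⁿ-S q _) (trans (cong (λ n → q + suc n) (length-φL^ (suc q) q)) (lemma q))))
  where
  -- the right-hand side is p * p + p ∸ 1 for p = suc q, with the ∸ 1 computed away
  lemma : ∀ q → q + suc (q * suc (suc q)) ≡ (q + q * suc q) + suc q
  lemma = solve-∀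

p²+p∸1≤p²+p : ∀ p → p * p + p ∸ 1 ≤ p * p + p
p²+p∸1≤p²+p p = m∸n≤m (p * p + p) 1

p²+p≤p²+2p : ∀ p → p * p + p ≤ p * p + 2 * p
p²+p≤p²+2p p = +-monoʳ-≤ (p * p) (m≤m+n p (p + 0))

between-gap-lengths : ∀ p {n} → n ≡ p * p + p ⊎ n ≡ p * p + 2 * p ⊎ n ≡ p * p + p ∸ 1 →
  p * p + p ∸ 1 ≤ n × n ≤ p * p + 2 * p
between-gap-lengths p (inj₁ refl)        = p²+p∸1≤p²+p p , p²+p≤p²+2p p
between-gap-lengths p (inj₂ (inj₁ refl)) = ≤-trans (p²+p∸1≤p²+p p) (p²+p≤p²+2p p) , ≤-refl
between-gap-lengths p (inj₂ (inj₂ refl)) = ≤-refl , ≤-trans (p²+p∸1≤p²+p p) (p²+p≤p²+2p p)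

mainTheorem9 : (p : ℕ) → 1 < p → (z : List Letter) →
    IsFactor p (M ∷ z ++ M ∷ []) → M ∉ z →
    (z ≡ ((L ∷ []) ^ʷ p ++ S ∷ []) ^ʷ p
      ⊎ z ≡ (L ∷ []) ^ʷ (p ∸ 1) ++ S ∷ [] ++ ((L ∷ []) ^ʷ p ++ S ∷ []) ^ʷ p
      ⊎ z ≡ (L ∷ []) ^ʷ (p ∸ 1) ++ S ∷ [] ++ ((L ∷ []) ^ʷ p ++ S ∷ []) ^ʷ (p ∸ 1))
    × (p * p + p ∸ 1 ≤ length z × length z ≤ p * p + 2 * p)
mainTheorem9 (suc (suc r)) (s≤s (s≤s _)) z factor M∉z =
  gap , between-gap-lengths (2 + r) (length-MGap (suc r) gap)
  where
  gap : MGap (2 + r) z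
  gap = MGap-of-factor r z factor M∉z
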